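{- In the setting of the context, let $f$ be a pseudoflow and $\mu$ a labeling that is $\Delta$-conservative for $f$, and let $0\le\Delta'<\Delta$. Then there exists a pseudoflow $\bar f$ such that $\mu$ is $\Delta'$-conservative for $\bar f$ and $Ex^\mu_{\Delta'}(\bar f)\le Ex^\mu_{\Delta}(f)+3m(\Delta-\Delta')$.
   Context: Let $G=(V,E)$ be a directed graph, $n=|V|$, $m=|E|$, $d_i$ the number of arcs incident to $i$, with upper capacities $u\ge0$, lower capacities $0$, gains $\gamma_{ij}>0$, node demands $b_i$, and finite positive penalty factors $M_i$. A pseudoflow is $f$ with $0\le f\le u$, with excess $e_i=\sum_{j:ji\in E}\gamma_{ji}f_{ji}-\sum_{j:ij\in E}f_{ij}-b_i$. Residual network $E_f$: forward arcs $ij\in E$ with $f_{ij}<u_{ij}$ (gain $\gamma_{ij}$), backward arcs $ij$ with $ji\in E$, $f_{ji}>0$ (gain $1/\gamma_{ji}$). The fatness of a residual arc is $s_f(ij)=\gamma_{ij}(u_{ij}-f_{ij})$ for forward arcs and $s_f(ij)=f_{ji}$ for backward arcs. For a labeling $\mu:V\to\mathbb{R}_{>0}$ let $\gamma^\mu_{ij}=\gamma_{ij}\mu_i/\mu_j$, $e^\mu_i=e_i/\mu_i$, $s^\mu_f(ij)=s_f(ij)/\mu_j$, and $E^\mu_f(\Delta)=\{ij\in E_f: s^\mu_f(ij)\ge\Delta\}$. A node $i$ is $\Delta$-negative if $e^\mu_i<d_i\Delta$. For $\Delta\ge0$, $\mu$ is $\Delta$-conservative (for $f$) if $\gamma^\mu_{ij}\le1$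 for all $ij\in E^\mu_f(\Delta)$, $\mu_i\ge1/M_i$ for all $i$, and $\mu_i=1/M_i$ for every $\Delta$-negative node $i$. Let $Ex^\mu_\Delta(f)=\sum_{i\in V}\max\{e^\mu_i-d_i\Delta,0\}$.
   Formalization: The capacities u, gains γ, demands b, penalty factors M, the labeling μ, the scales Δ and Δ′, and the pseudoflows f and $\bar f$ take rational values rather than real ones. -}

module Defs where

open import Data.Nat as ℕ using (ℕ)
open import Data.Fin using (Fin; zero; suc; _≟_)
open import Data.Bool using (Bool; if_then_else_; _∨_)
open import Data.Integer using (+_)
open import Data.Rational
  using (ℚ; 0ℚ; 1ℚ; _+_; _-_; _*_; _/_; 1/_; _⊔_; _≤_; _<_; Positive)
open import Data.Rational.Properties using (pos⇒nonZero)
open import Data.Product using (Σ; _×_)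
open import Relation.Nullary.Decidable using (⌊_⌋)
open import Relation.Binary.PropositionalEquality using (_≡_)

ℕtoℚ : ℕ → ℚ
ℕtoℚ k = (+ k) / 1

∑ : ∀ {k} → (Fin k → ℚ) → ℚ
∑ {ℕ.zero}  g = 0ℚ
∑ {ℕ.suc k} g = g zero + ∑ (λ i → g (suc i))

inv : (p : ℚ) → Positive p → ℚ
inv p pp = (1/ p) {{pos⇒nonZero p {{pp}}}}

record Network : Set where
  field
    n m      : ℕ
    tail head : Fin m → Fin n
    -- E ⊆ V × V : no two distinct arcs with the same (tail, head)
    simple   : ∀ a a' → tail a ≡ tail a' → head a ≡ head a' → a ≡ a'
    u        : Fin m → ℚ
    u≥0      : ∀ a → 0ℚ ≤ u a
    γ        : Fin m → ℚ
    γ>0      : ∀ a → Positive (γ a)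
    b        : Fin n → ℚ
    M        : Fin n → ℚ
    M>0      : ∀ i → Positive (M i)

module _ (N : Network) where
  open Network N

  Flow : Set
  Flow = Fin m → ℚ

  Pseudoflow : Flow → Set
  Pseudoflow f = ∀ a → (0ℚ ≤ f a) × (f a ≤ u a)

  excess : Flow → Fin n → ℚ
  excess f i =
    ∑ (λ a → if ⌊ head a ≟ i ⌋ then γ a * f a else 0ℚ)
    - ∑ (λ a → if ⌊ tail a ≟ i ⌋ then f a else 0ℚ)
    - b i

  deg : Fin n → ℚ
  deg i = ∑ (λ a → if ⌊ tail a ≟ i ⌋ ∨ ⌊ head a ≟ i ⌋ then 1ℚ else 0ℚ)

  record Labeling : Set where
    field
      μ    : Fin n → ℚ
      μ>0  : ∀ i → Positive (μ i)

  module _ (f : Flow) (L : Labeling) where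
    open Labeling L

    invμ : Fin n → ℚ
    invμ i = inv (μ i) (μ>0 i)

    excessμ : Fin n → ℚ
    excessμ i = excess f i * invμ i

    -- Residual arcs: forward copy of arc a (exists iff f a < u a), tail a → head a,
    -- gain γ_a, fatness γ_a (u_a − f_a);
    -- backward copy of arc a (exists iff 0 < f a), head a → tail a,
    -- gain 1/γ_a, fatness f_a.

    fwdResidual : Fin m → Set
    fwdResidual a = f a < u a

    fwdGainμ : Fin m → ℚ
    fwdGainμ a = γ a * μ (tail a) * invμ (head a)

    fwdFatμ : Fin m → ℚ
    fwdFatμ a = (γ a * (u a - f a)) * invμ (head a)

    bwdResidual : Fin m → Set
    bwdResidual a = 0ℚ < f a

    bwdGainμ : Fin m → ℚ
    bwdGainμ a = inv (γ a) (γ>0 a) * μ (head a) * invμ (tail a)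

    bwdFatμ : Fin m → ℚ
    bwdFatμ a = f a * invμ (tail a)

    Negative : ℚ → Fin n → Set
    Negative Δ i = excessμ i < deg i * Δ

    Conservative : ℚ → Set
    Conservative Δ =
        (∀ a → fwdResidual a → Δ ≤ fwdFatμ a → fwdGainμ a ≤ 1ℚ)
      × (∀ a → bwdResidual a → Δ ≤ bwdFatμ a → bwdGainμ a ≤ 1ℚ)
      × (∀ i → inv (M i) (M>0 i) ≤ μ i)
      × (∀ i → Negative Δ i → μ i ≡ inv (M i) (M>0 i))

    Ex : ℚ → ℚ
    Ex Δ = ∑ (λ i → (excessμ i - deg i * Δ) ⊔ 0ℚ)

{-# OPTIONS --safe #-}
-- Put δ = Δ − Δ'. Every arc whose relabeled gain exceeds 1 is pushed forward
-- until its relabeled forward fatness s has dropped to (s − δ)⁺, every arc whose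
-- reverse has gain above 1 is pulled back in the same way, and all other arcs are
-- kept. A residual arc of gain above 1 that is still Δ'-fat afterwards was Δ-fat
-- before, which Δ-conservativity rules out.
--
-- On each arc the relabeled excess change α at the head and the relabeled outflow
-- change β at the tail satisfy α = γ^μ β, so either 0 ≤ β ≤ α ≤ δ or
-- −δ ≤ β ≤ α ≤ 0. Hence a node loses at most δ of relabeled excess per incident
-- arc, so Δ'-negative nodes were Δ-negative. Lowering the threshold from Δ to Δ'
-- raises e^μ_i − d_i Δ by d_i δ, and an arc raises the excesses at its two ends by
-- at most α⁺ + (−β)⁺ ≤ δ in total; so each arc accounts for at most 2δ + δ of the
-- increase of Ex.
module Submission where

open import Defs
open import Data.Nat using (_*_)
open import Data.Rational using (ℚ; 0ℚ; _≤_; _<_; _+_; _-_)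
open import Data.Rational using () renaming (_*_ to _*ℚ_)
open import Data.Product using (Σ; _×_)

open import Level using (0ℓ)
open import Data.Bool using (Bool; true; false; if_then_else_; _∨_)
open import Data.Empty using (⊥-elim)
open import Data.Fin using (Fin; zero; suc; _≟_)
import Data.Nat as ℕ
import Data.Nat.Coprimality as Coprimality
import Data.Integer as ℤ
import Data.Integer.Properties as ℤ
open import Data.Product using (_,_; proj₁; proj₂)
open import Data.Rational as ℚ using (1ℚ; -_; _⊔_; mkℚ; nonNegative; nonPositive; positive)
open import Data.Rational.Properties as ℚ hiding (_≟_)
open import Data.Sum using (_⊎_; inj₁; inj₂)
open import Function using (_∘_)
open import Relation.Binary.PropositionalEquality
open import Relation.Nullary using (yes; no)
open import Relation.Nullary.Decidable using (⌊_⌋)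
open import Relation.Nullary.Decidable.Core using (dec⇒maybe)
open import Tactic.RingSolver using (solve-∀)
open import Tactic.RingSolver.Core.AlmostCommutativeRing
  using (AlmostCommutativeRing; fromCommutativeRing)

ringℚ : AlmostCommutativeRing 0ℓ 0ℓ
ringℚ = fromCommutativeRing +-*-commutativeRing (λ x → dec⇒maybe (0ℚ ℚ.≟ x))

q-p+p≡q : ∀ q p → q - p + p ≡ q
q-p+p≡q = solve-∀ ringℚ

p+[q-p]≡q : ∀ p q → p + (q - p) ≡ q
p+[q-p]≡q = solve-∀ ringℚ

p≤q⇒0≤q-p : ∀ {p q} → p ≤ q → 0ℚ ≤ q - p
p≤q⇒0≤q-p {p} {q} p≤q = subst (_≤ q - p) (+-inverseʳ p) (+-monoˡ-≤ (- p) p≤q)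

p<q⇒0<q-p : ∀ {p q} → p < q → 0ℚ < q - p
p<q⇒0<q-p {p} {q} p<q = subst (_< q - p) (+-inverseʳ p) (+-monoˡ-< (- p) p<q)

0≤q-p⇒p≤q : ∀ {p q} → 0ℚ ≤ q - p → p ≤ q
0≤q-p⇒p≤q {p} {q} h = subst₂ _≤_ (+-identityˡ p) (q-p+p≡q q p) (+-monoˡ-≤ p h)

q-p≤0⇒q≤p : ∀ {p q} → q - p ≤ 0ℚ → q ≤ p
q-p≤0⇒q≤p {p} {q} h = subst₂ _≤_ (q-p+p≡q q p) (+-identityˡ p) (+-monoˡ-≤ p h)

0<q-p⇒p<q : ∀ {p q} → 0ℚ < q - p → p < q
0<q-p⇒p<q {p} {q} h = subst₂ _<_ (+-identityˡ p) (q-p+p≡q q p) (+-monoˡ-< p h)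

p-q≤p : ∀ p {q} → 0ℚ ≤ q → p - q ≤ p
p-q≤p p 0≤q = subst (p - _ ≤_) (+-identityʳ p) (+-monoʳ-≤ p (neg-antimono-≤ 0≤q))

0≤* : ∀ {p q} → 0ℚ ≤ p → 0ℚ ≤ q → 0ℚ ≤ p *ℚ q
0≤* {p} {q} 0≤p 0≤q =
  nonNegative⁻¹ _ {{nonNeg*nonNeg⇒nonNeg p {{nonNegative 0≤p}} q {{nonNegative 0≤q}}}}

0<* : ∀ {p q} → 0ℚ < p → 0ℚ < q → 0ℚ < p *ℚ q
0<* {p} {q} 0<p 0<q = positive⁻¹ _ {{pos*pos⇒pos p {{positive 0<p}} q {{positive 0<q}}}}

0<*⇒0< : ∀ {p q} → 0ℚ < q → 0ℚ < p *ℚ q → 0ℚ < p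
0<*⇒0< {p} {q} 0<q h =
  *-cancelʳ-<-nonNeg q {{nonNegative (<⇒≤ 0<q)}} (subst (_< p *ℚ q) (sym (*-zeroˡ q)) h)

0≤*⇒0≤ : ∀ {p q} → 0ℚ < q → 0ℚ ≤ p *ℚ q → 0ℚ ≤ p
0≤*⇒0≤ {p} {q} 0<q h =
  *-cancelʳ-≤-pos q {{positive 0<q}} (subst (_≤ p *ℚ q) (sym (*-zeroˡ q)) h)

*≤0⇒≤0 : ∀ {p q} → 0ℚ < q → p *ℚ q ≤ 0ℚ → p ≤ 0ℚ
*≤0⇒≤0 {p} {q} 0<q h =
  *-cancelʳ-≤-pos q {{positive 0<q}} (subst (p *ℚ q ≤_) (sym (*-zeroˡ q)) h)

p*q≡1∧1<q⇒p≤1 : ∀ {p q} → p *ℚ q ≡ 1ℚ → 1ℚ < q → p ≤ 1ℚ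
p*q≡1∧1<q⇒p≤1 {p} {q} pq≡1 1<q = ≮⇒≥ λ 1<p →
  <-asym 1<q (subst₂ _<_ (*-identityˡ q) pq≡1 (*-monoˡ-<-pos q {{0<q}} 1<p))
  where
  0<q : ℚ.Positive q
  0<q = positive (<-trans (positive⁻¹ 1ℚ) 1<q)

_⁺ : ℚ → ℚ
x ⁺ = x ⊔ 0ℚ

0≤⁺ : ∀ x → 0ℚ ≤ x ⁺
0≤⁺ x = p≤q⊔p x 0ℚ

≤⁺ : ∀ x → x ≤ x ⁺
≤⁺ x = p≤p⊔q x 0ℚ

0<⁺⇒⁺≡ : ∀ {x} → 0ℚ < x ⁺ → x ⁺ ≡ x
0<⁺⇒⁺≡ {x} 0<x⁺ with ≤-total x 0ℚ
... | inj₁ x≤0 = ⊥-elim (<-irrefl (sym (p≤q⇒p⊔q≡q x≤0)) 0<x⁺)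
... | inj₂ 0≤x = p≥q⇒p⊔q≡p 0≤x

⁺-≤-+ : ∀ {x y z} → x ≤ y + z → 0ℚ ≤ z → x ⁺ ≤ y ⁺ + z
⁺-≤-+ {x} {y} {z} x≤y+z 0≤z =
  ⊔-lub (≤-trans x≤y+z (+-monoˡ-≤ z (≤⁺ y))) (+-mono-≤ (0≤⁺ y) 0≤z)

0≤p-[p-q]⁺ : ∀ {p q} → 0ℚ ≤ p → 0ℚ ≤ q → 0ℚ ≤ p - (p - q) ⁺
0≤p-[p-q]⁺ {p} {q} 0≤p 0≤q = p≤q⇒0≤q-p (⊔-lub (p-q≤p p 0≤q) 0≤p)

p-[p-q]⁺≤q : ∀ p q → p - (p - q) ⁺ ≤ q
p-[p-q]⁺≤q p q = begin
  p - (p - q) ⁺    ≤⟨ +-monoʳ-≤ p (neg-antimono-≤ (≤⁺ (p - q))) ⟩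
  p - (p - q)      ≡⟨ p-[p-q]≡q p q ⟩
  q                ∎
  where
  open ≤-Reasoning
  p-[p-q]≡q : ∀ p q → p - (p - q) ≡ q
  p-[p-q]≡q = solve-∀ ringℚ

-- Finite sums

when : Bool → ℚ → ℚ
when b x = if b then x else 0ℚ

∑-cong : ∀ {k} {g h : Fin k → ℚ} → (∀ a → g a ≡ h a) → ∑ g ≡ ∑ h
∑-cong {ℕ.zero}  g≡h = refl
∑-cong {ℕ.suc k} g≡h = cong₂ _+_ (g≡h zero) (∑-cong (g≡h ∘ suc))

∑-mono-≤ : ∀ {k} {g h : Fin k → ℚ} → (∀ a → g a ≤ h a) → ∑ g ≤ ∑ h
∑-mono-≤ {ℕ.zero}  g≤h = ≤-refl
∑-mono-≤ {ℕ.suc k} g≤h = +-mono-≤ (g≤h zero) (∑-mono-≤ (g≤h ∘ suc))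

∑-zero : ∀ {k} → ∑ {k} (λ _ → 0ℚ) ≡ 0ℚ
∑-zero {ℕ.zero}  = refl
∑-zero {ℕ.suc k} = trans (+-identityˡ _) (∑-zero {k})

∑-nonNeg : ∀ {k} {g : Fin k → ℚ} → (∀ a → 0ℚ ≤ g a) → 0ℚ ≤ ∑ g
∑-nonNeg {k} {g} 0≤g = subst (_≤ ∑ g) (∑-zero {k}) (∑-mono-≤ 0≤g)

∑-distrib-+ : ∀ {k} (g h : Fin k → ℚ) → ∑ (λ a → g a + h a) ≡ ∑ g + ∑ h
∑-distrib-+ {ℕ.zero}  g h = refl
∑-distrib-+ {ℕ.suc k} g h = begin
  (g zero + h zero) + ∑ (λ a → g (suc a) + h (suc a))
    ≡⟨ cong ((g zero + h zero) +_) (∑-distrib-+ (g ∘ suc) (h ∘ suc)) ⟩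
  (g zero + h zero) + (∑ (g ∘ suc) + ∑ (h ∘ suc))
    ≡⟨ interchange (g zero) (h zero) (∑ (g ∘ suc)) (∑ (h ∘ suc)) ⟩
  (g zero + ∑ (g ∘ suc)) + (h zero + ∑ (h ∘ suc))
    ∎
  where
  open ≡-Reasoning
  interchange : ∀ w x y z → (w + x) + (y + z) ≡ (w + y) + (x + z)
  interchange = solve-∀ ringℚ

∑-neg : ∀ {k} (g : Fin k → ℚ) → ∑ (λ a → - g a) ≡ - ∑ g
∑-neg {ℕ.zero}  g = refl
∑-neg {ℕ.suc k} g =
  trans (cong (- g zero +_) (∑-neg (g ∘ suc))) (sym (neg-distrib-+ (g zero) (∑ (g ∘ suc))))

∑-distrib-sub : ∀ {k} (g h : Fin k → ℚ) → ∑ (λ a → g a - h a) ≡ ∑ g - ∑ h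
∑-distrib-sub g h = trans (∑-distrib-+ g (λ a → - h a)) (cong (∑ g +_) (∑-neg h))

∑-*ʳ : ∀ {k} (g : Fin k → ℚ) c → ∑ (λ a → g a *ℚ c) ≡ ∑ g *ℚ c
∑-*ʳ {ℕ.zero}  g c = sym (*-zeroˡ c)
∑-*ʳ {ℕ.suc k} g c =
  trans (cong (g zero *ℚ c +_) (∑-*ʳ (g ∘ suc) c)) (sym (*-distribʳ-+ c (g zero) _))

∑-comm : ∀ {k l} (g : Fin k → Fin l → ℚ) →
  ∑ (λ i → ∑ (g i)) ≡ ∑ (λ a → ∑ (λ i → g i a))
∑-comm {ℕ.zero}  {l} g = sym (∑-zero {l})
∑-comm {ℕ.suc k} g =
  trans (cong (∑ (g zero) +_) (∑-comm (g ∘ suc))) (sym (∑-distrib-+ (g zero) _))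

∑-indicator : ∀ {k} (j : Fin k) x → ∑ (λ i → when ⌊ j ≟ i ⌋ x) ≡ x
∑-indicator {ℕ.suc k} zero    x = trans (cong (x +_) (∑-zero {k})) (+-identityʳ x)
∑-indicator {ℕ.suc k} (suc j) x =
  trans (+-identityˡ _) (trans (∑-cong (when-suc≟suc j)) (∑-indicator j x))
  where
  when-suc≟suc : ∀ {k} (j i : Fin k) → when ⌊ suc j ≟ suc i ⌋ x ≡ when ⌊ j ≟ i ⌋ x
  when-suc≟suc j i with j ≟ i
  ... | yes _ = refl
  ... | no _  = refl

∑-indicator₂ : ∀ {k} (j j′ : Fin k) x y →
  ∑ (λ i → when ⌊ j ≟ i ⌋ x + when ⌊ j′ ≟ i ⌋ y) ≡ x + y
∑-indicator₂ j j′ x y =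
  trans (∑-distrib-+ (λ i → when ⌊ j ≟ i ⌋ x) (λ i → when ⌊ j′ ≟ i ⌋ y))
        (cong₂ _+_ (∑-indicator j x) (∑-indicator j′ y))

ℕtoℚ≡mkℚ : ∀ k →
  ℕtoℚ k ≡ mkℚ (ℤ.+ k) 0 (Coprimality.sym (Coprimality.1-coprimeTo k))
ℕtoℚ≡mkℚ k = ↥p/↧p≡p (mkℚ (ℤ.+ k) 0 (Coprimality.sym (Coprimality.1-coprimeTo k)))

ℕtoℚ-+ : ∀ j k → ℕtoℚ (j ℕ.+ k) ≡ ℕtoℚ j + ℕtoℚ k
ℕtoℚ-+ j k = begin
  ℕtoℚ (j ℕ.+ k)                                ≡⟨ cong (ℚ._/ 1) numerator ⟩
  (ℤ.+ j ℤ.* ℤ.+ 1 ℤ.+ ℤ.+ k ℤ.* ℤ.+ 1) ℚ./ 1   ≡⟨⟩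
  mkℚ (ℤ.+ j) 0 c₁ + mkℚ (ℤ.+ k) 0 c₂           ≡⟨ cong₂ _+_ (ℕtoℚ≡mkℚ j) (ℕtoℚ≡mkℚ k) ⟨
  ℕtoℚ j + ℕtoℚ k                               ∎
  where
  open ≡-Reasoning
  c₁ : Coprimality.Coprime j 1
  c₁ = Coprimality.sym (Coprimality.1-coprimeTo j)
  c₂ : Coprimality.Coprime k 1
  c₂ = Coprimality.sym (Coprimality.1-coprimeTo k)
  numerator : ℤ.+ (j ℕ.+ k) ≡ ℤ.+ j ℤ.* ℤ.+ 1 ℤ.+ ℤ.+ k ℤ.* ℤ.+ 1
  numerator =
    trans (ℤ.pos-+ j k) (sym (cong₂ ℤ._+_ (ℤ.*-identityʳ (ℤ.+ j)) (ℤ.*-identityʳ (ℤ.+ k))))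

∑-const : ∀ {k} c → ∑ {k} (λ _ → c) ≡ ℕtoℚ k *ℚ c
∑-const {ℕ.zero}  c = sym (*-zeroˡ c)
∑-const {ℕ.suc k} c = begin
  c + ∑ {k} (λ _ → c)       ≡⟨ cong (c +_) (∑-const {k} c) ⟩
  c + ℕtoℚ k *ℚ c           ≡⟨ cong (_+ ℕtoℚ k *ℚ c) (*-identityˡ c) ⟨
  1ℚ *ℚ c + ℕtoℚ k *ℚ c     ≡⟨ *-distribʳ-+ c 1ℚ (ℕtoℚ k) ⟨
  (1ℚ + ℕtoℚ k) *ℚ c        ≡⟨ cong (_*ℚ c) (ℕtoℚ-+ 1 k) ⟨
  ℕtoℚ (ℕ.suc k) *ℚ c       ∎
  where open ≡-Reasoning

ℕtoℚ[3*k]*x : ∀ k x → ℕtoℚ (3 * k) *ℚ x ≡ ℕtoℚ k *ℚ ((x + x) + x)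
ℕtoℚ[3*k]*x k x = begin
  ℕtoℚ (k ℕ.+ (k ℕ.+ (k ℕ.+ 0))) *ℚ x   ≡⟨ cong (_*ℚ x) ℕtoℚ[3*k] ⟩
  (K + (K + (K + 0ℚ))) *ℚ x              ≡⟨ regroup K x ⟩
  K *ℚ ((x + x) + x)                     ∎
  where
  open ≡-Reasoning
  K : ℚ
  K = ℕtoℚ k
  ℕtoℚ[3*k] : ℕtoℚ (k ℕ.+ (k ℕ.+ (k ℕ.+ 0))) ≡ K + (K + (K + 0ℚ))
  ℕtoℚ[3*k] =
    trans (ℕtoℚ-+ k _) (cong (K +_) (trans (ℕtoℚ-+ k _) (cong (K +_) (ℕtoℚ-+ k 0))))
  regroup : ∀ K x → (K + (K + (K + 0ℚ))) *ℚ x ≡ K *ℚ ((x + x) + x)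
  regroup = solve-∀ ringℚ

-- Arcs moving their end excesses by at most δ

StepBound : ℚ → ℚ → ℚ → Set
StepBound δ α β = (0ℚ ≤ β × β ≤ α × α ≤ δ) ⊎ (- δ ≤ β × β ≤ α × α ≤ 0ℚ)

module _ {δ α β : ℚ} (0≤δ : 0ℚ ≤ δ) where

  StepBound⇒β≤α : StepBound δ α β → β ≤ α
  StepBound⇒β≤α (inj₁ (_ , β≤α , _)) = β≤α
  StepBound⇒β≤α (inj₂ (_ , β≤α , _)) = β≤α

  StepBound⇒-δ≤α : StepBound δ α β → - δ ≤ α
  StepBound⇒-δ≤α (inj₁ (0≤β , β≤α , _)) = ≤-trans (neg-antimono-≤ 0≤δ) (≤-trans 0≤β β≤α)
  StepBound⇒-δ≤α (inj₂ (-δ≤β , β≤α , _)) = ≤-trans -δ≤β β≤α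

  StepBound⇒β≤δ : StepBound δ α β → β ≤ δ
  StepBound⇒β≤δ (inj₁ (_ , β≤α , α≤δ)) = ≤-trans β≤α α≤δ
  StepBound⇒β≤δ (inj₂ (_ , β≤α , α≤0)) = ≤-trans β≤α (≤-trans α≤0 0≤δ)

  StepBound⇒α⁺+[-β]⁺≤δ : StepBound δ α β → α ⁺ + (- β) ⁺ ≤ δ
  StepBound⇒α⁺+[-β]⁺≤δ (inj₁ (0≤β , β≤α , α≤δ)) = begin
    α ⁺ + (- β) ⁺   ≡⟨ cong₂ _+_ (p≥q⇒p⊔q≡p (≤-trans 0≤β β≤α))
                                 (p≤q⇒p⊔q≡q (neg-antimono-≤ 0≤β)) ⟩
    α + 0ℚ          ≡⟨ +-identityʳ α ⟩
    α               ≤⟨ α≤δ ⟩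
    δ               ∎
    where open ≤-Reasoning
  StepBound⇒α⁺+[-β]⁺≤δ (inj₂ (-δ≤β , β≤α , α≤0)) = begin
    α ⁺ + (- β) ⁺   ≡⟨ cong₂ _+_ (p≤q⇒p⊔q≡q α≤0)
                                 (p≥q⇒p⊔q≡p (neg-antimono-≤ (≤-trans β≤α α≤0))) ⟩
    0ℚ + - β        ≡⟨ +-identityˡ (- β) ⟩
    - β             ≤⟨ neg-antimono-≤ -δ≤β ⟩
    - - δ           ≡⟨ neg-involutive δ ⟩
    δ               ∎
    where
    open ≤-Reasoning
    neg-involutive : ∀ x → - - x ≡ x
    neg-involutive = solve-∀ ringℚ

  contribution-lower : StepBound δ α β → ∀ bh bt →
    - (when (bt ∨ bh) 1ℚ *ℚ δ) ≤ when bh α - when bt β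
  contribution-lower s true true = begin
    - (1ℚ *ℚ δ)   ≡⟨ cong -_ (*-identityˡ δ) ⟩
    - δ           ≤⟨ neg-antimono-≤ 0≤δ ⟩
    0ℚ            ≤⟨ p≤q⇒0≤q-p (StepBound⇒β≤α s) ⟩
    α - β         ∎
    where open ≤-Reasoning
  contribution-lower s true false =
    subst₂ _≤_ (cong -_ (sym (*-identityˡ δ))) (sym (+-identityʳ α)) (StepBound⇒-δ≤α s)
  contribution-lower s false true =
    subst₂ _≤_ (cong -_ (sym (*-identityˡ δ))) (sym (+-identityˡ (- β)))
               (neg-antimono-≤ (StepBound⇒β≤δ s))
  contribution-lower s false false = ≤-reflexive (cong -_ (*-zeroˡ δ))

contribution-upper : ∀ bh bt α β →
  when bh α - when bt β ≤ when bh (α ⁺) + when bt ((- β) ⁺)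
contribution-upper true  true  α β = +-mono-≤ (≤⁺ α) (≤⁺ (- β))
contribution-upper true  false α β = +-mono-≤ (≤⁺ α) (≤-refl {0ℚ})
contribution-upper false true  α β = +-mono-≤ (≤-refl {0ℚ}) (≤⁺ (- β))
contribution-upper false false α β = ≤-refl

when-∨-≤ : ∀ {δ} → 0ℚ ≤ δ → ∀ bt bh → when (bt ∨ bh) 1ℚ *ℚ δ ≤ when bt δ + when bh δ
when-∨-≤ {δ} 0≤δ true  true  =
  ≤-trans (≤-reflexive (trans (*-identityˡ δ) (sym (+-identityʳ δ)))) (+-monoʳ-≤ δ 0≤δ)
when-∨-≤ {δ} 0≤δ true  false = ≤-reflexive (trans (*-identityˡ δ) (sym (+-identityʳ δ)))
when-∨-≤ {δ} 0≤δ false true  = ≤-reflexive (trans (*-identityˡ δ) (sym (+-identityˡ δ)))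
when-∨-≤ {δ} 0≤δ false false = ≤-reflexive (*-zeroˡ δ)

0≤when : ∀ {x} b → 0ℚ ≤ x → 0ℚ ≤ when b x
0≤when true  0≤x = 0≤x
0≤when false _   = ≤-refl

-- Relabeled quantities

module Relabeled (N : Network) (L : Labeling N) where
  open Network N
  open Labeling L

  μ⁻¹ : Fin n → ℚ
  μ⁻¹ i = inv (μ i) (μ>0 i)

  γ⁻¹ : Fin m → ℚ
  γ⁻¹ a = inv (γ a) (γ>0 a)

  fwdGain bwdGain : Fin m → ℚ
  fwdGain a = γ a *ℚ μ (tail a) *ℚ μ⁻¹ (head a)
  bwdGain a = γ⁻¹ a *ℚ μ (head a) *ℚ μ⁻¹ (tail a)

  fwdFat bwdFat : Fin m → ℚ → ℚ
  fwdFat a x = γ a *ℚ (u a - x) *ℚ μ⁻¹ (head a)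
  bwdFat a x = x *ℚ μ⁻¹ (tail a)

  headChange tailChange : Fin m → ℚ → ℚ → ℚ
  headChange a x x̄ = γ a *ℚ (x̄ - x) *ℚ μ⁻¹ (head a)
  tailChange a x x̄ = (x̄ - x) *ℚ μ⁻¹ (tail a)

  0<μ : ∀ i → 0ℚ < μ i
  0<μ i = positive⁻¹ (μ i) {{μ>0 i}}

  0<μ⁻¹ : ∀ i → 0ℚ < μ⁻¹ i
  0<μ⁻¹ i = positive⁻¹ (μ⁻¹ i) {{1/pos⇒pos (μ i) {{μ>0 i}}}}

  0<γ : ∀ a → 0ℚ < γ a
  0<γ a = positive⁻¹ (γ a) {{γ>0 a}}

  0<γ⁻¹ : ∀ a → 0ℚ < γ⁻¹ a
  0<γ⁻¹ a = positive⁻¹ (γ⁻¹ a) {{1/pos⇒pos (γ a) {{γ>0 a}}}}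

  μ*μ⁻¹ : ∀ i → μ i *ℚ μ⁻¹ i ≡ 1ℚ
  μ*μ⁻¹ i = *-inverseʳ (μ i) {{pos⇒nonZero (μ i) {{μ>0 i}}}}

  γ*γ⁻¹ : ∀ a → γ a *ℚ γ⁻¹ a ≡ 1ℚ
  γ*γ⁻¹ a = *-inverseʳ (γ a) {{pos⇒nonZero (γ a) {{γ>0 a}}}}

  0<fwdGain : ∀ a → 0ℚ < fwdGain a
  0<fwdGain a = 0<* (0<* (0<γ a) (0<μ (tail a))) (0<μ⁻¹ (head a))

  fwdGain*bwdGain : ∀ a → fwdGain a *ℚ bwdGain a ≡ 1ℚ
  fwdGain*bwdGain a = begin
    fwdGain a *ℚ bwdGain a
      ≡⟨ regroup (γ a) (γ⁻¹ a) (μ (tail a)) (μ⁻¹ (tail a)) (μ (head a)) (μ⁻¹ (head a)) ⟩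
    (γ a *ℚ γ⁻¹ a) *ℚ (μ (tail a) *ℚ μ⁻¹ (tail a)) *ℚ (μ (head a) *ℚ μ⁻¹ (head a))
      ≡⟨ cong₂ _*ℚ_ (cong₂ _*ℚ_ (γ*γ⁻¹ a) (μ*μ⁻¹ (tail a))) (μ*μ⁻¹ (head a)) ⟩
    1ℚ
      ∎
    where
    open ≡-Reasoning
    regroup : ∀ g g⁻¹ t t⁻¹ h h⁻¹ →
      (g *ℚ t *ℚ h⁻¹) *ℚ (g⁻¹ *ℚ h *ℚ t⁻¹) ≡ (g *ℚ g⁻¹) *ℚ (t *ℚ t⁻¹) *ℚ (h *ℚ h⁻¹)
    regroup = solve-∀ ringℚ

  bwdGain*fwdGain : ∀ a → bwdGain a *ℚ fwdGain a ≡ 1ℚ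
  bwdGain*fwdGain a = trans (*-comm (bwdGain a) (fwdGain a)) (fwdGain*bwdGain a)

  headChange≡tailChange*fwdGain : ∀ a x x̄ →
    headChange a x x̄ ≡ tailChange a x x̄ *ℚ fwdGain a
  headChange≡tailChange*fwdGain a x x̄ = begin
    headChange a x x̄
      ≡⟨ *-identityʳ (headChange a x x̄) ⟨
    headChange a x x̄ *ℚ 1ℚ
      ≡⟨ cong (headChange a x x̄ *ℚ_) (μ*μ⁻¹ (tail a)) ⟨
    headChange a x x̄ *ℚ (μ (tail a) *ℚ μ⁻¹ (tail a))
      ≡⟨ regroup (γ a) (x̄ - x) (μ⁻¹ (head a)) (μ (tail a)) (μ⁻¹ (tail a)) ⟩
    tailChange a x x̄ *ℚ fwdGain a
      ∎
    where
    open ≡-Reasoning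
    regroup : ∀ g d h⁻¹ t t⁻¹ → g *ℚ d *ℚ h⁻¹ *ℚ (t *ℚ t⁻¹) ≡ d *ℚ t⁻¹ *ℚ (g *ℚ t *ℚ h⁻¹)
    regroup = solve-∀ ringℚ

  headChange≡Δfwd : ∀ a x x̄ → headChange a x x̄ ≡ fwdFat a x - fwdFat a x̄
  headChange≡Δfwd a x x̄ = difference (γ a) (u a) x x̄ (μ⁻¹ (head a))
    where
    difference : ∀ g u x x̄ w → g *ℚ (x̄ - x) *ℚ w ≡ g *ℚ (u - x) *ℚ w - g *ℚ (u - x̄) *ℚ w
    difference = solve-∀ ringℚ

  tailChange≡Δbwd : ∀ a x x̄ → tailChange a x x̄ ≡ bwdFat a x̄ - bwdFat a x
  tailChange≡Δbwd a x x̄ = difference x x̄ (μ⁻¹ (tail a))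
    where
    difference : ∀ x x̄ w → (x̄ - x) *ℚ w ≡ x̄ *ℚ w - x *ℚ w
    difference = solve-∀ ringℚ

  0≤fwdFat : ∀ {a x} → x ≤ u a → 0ℚ ≤ fwdFat a x
  0≤fwdFat {a} x≤u = 0≤* (0≤* (<⇒≤ (0<γ a)) (p≤q⇒0≤q-p x≤u)) (<⇒≤ (0<μ⁻¹ (head a)))

  0≤bwdFat : ∀ {a x} → 0ℚ ≤ x → 0ℚ ≤ bwdFat a x
  0≤bwdFat {a} 0≤x = 0≤* 0≤x (<⇒≤ (0<μ⁻¹ (tail a)))

  <⇒0<fwdFat : ∀ {a x} → x < u a → 0ℚ < fwdFat a x
  <⇒0<fwdFat {a} x<u = 0<* (0<* (0<γ a) (p<q⇒0<q-p x<u)) (0<μ⁻¹ (head a))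

  0<fwdFat⇒< : ∀ {a x} → 0ℚ < fwdFat a x → x < u a
  0<fwdFat⇒< {a} {x} 0<fat =
    0<q-p⇒p<q (0<*⇒0< (0<γ a) (subst (0ℚ <_) (*-comm (γ a) (u a - x)) 0<γ*[u-x]))
    where
    0<γ*[u-x] : 0ℚ < γ a *ℚ (u a - x)
    0<γ*[u-x] = 0<*⇒0< (0<μ⁻¹ (head a)) 0<fat

  0<⇒0<bwdFat : ∀ {a x} → 0ℚ < x → 0ℚ < bwdFat a x
  0<⇒0<bwdFat {a} 0<x = 0<* 0<x (0<μ⁻¹ (tail a))

  0<bwdFat⇒0< : ∀ {a x} → 0ℚ < bwdFat a x → 0ℚ < x
  0<bwdFat⇒0< {a} = 0<*⇒0< (0<μ⁻¹ (tail a))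

  atHead atTail : Fin m → Fin n → Bool
  atHead a i = ⌊ head a ≟ i ⌋
  atTail a i = ⌊ tail a ≟ i ⌋

  incident : Fin m → Fin n → ℚ
  incident a i = when (atTail a i ∨ atHead a i) 1ℚ

  inflow : Flow N → Fin m → Fin n → ℚ
  inflow g a i = when (atHead a i) (γ a *ℚ g a) - when (atTail a i) (g a)

  excessμ≡∑inflow : ∀ g i →
    excessμ N g L i ≡ ∑ (λ a → inflow g a i *ℚ μ⁻¹ i) - b i *ℚ μ⁻¹ i
  excessμ≡∑inflow g i = begin
    excess N g i *ℚ μ⁻¹ i
      ≡⟨ cong (λ s → (s - b i) *ℚ μ⁻¹ i) (∑-distrib-sub inflowʰ inflowᵗ) ⟨
    (∑ (λ a → inflow g a i) - b i) *ℚ μ⁻¹ i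
      ≡⟨ distrib (∑ (λ a → inflow g a i)) (b i) (μ⁻¹ i) ⟩
    ∑ (λ a → inflow g a i) *ℚ μ⁻¹ i - b i *ℚ μ⁻¹ i
      ≡⟨ cong (_- b i *ℚ μ⁻¹ i) (∑-*ʳ (λ a → inflow g a i) (μ⁻¹ i)) ⟨
    ∑ (λ a → inflow g a i *ℚ μ⁻¹ i) - b i *ℚ μ⁻¹ i
      ∎
    where
    open ≡-Reasoning
    inflowʰ inflowᵗ : Fin m → ℚ
    inflowʰ a = when (atHead a i) (γ a *ℚ g a)
    inflowᵗ a = when (atTail a i) (g a)
    distrib : ∀ s b w → (s - b) *ℚ w ≡ s *ℚ w - b *ℚ w
    distrib = solve-∀ ringℚ

  module FlowChange (f f̄ : Flow N) (Δ Δ' : ℚ) (Δ'≤Δ : Δ' ≤ Δ)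
    (bounded : ∀ a → StepBound (Δ - Δ') (headChange a (f a) (f̄ a)) (tailChange a (f a) (f̄ a)))
    where

    δ : ℚ
    δ = Δ - Δ'

    0≤δ : 0ℚ ≤ δ
    0≤δ = p≤q⇒0≤q-p Δ'≤Δ

    α β : Fin m → ℚ
    α a = headChange a (f a) (f̄ a)
    β a = tailChange a (f a) (f̄ a)

    contribution : Fin m → Fin n → ℚ
    contribution a i = when (atHead a i) (α a) - when (atTail a i) (β a)

    nodeChange : Fin n → ℚ
    nodeChange i = ∑ (λ a → contribution a i)

    inflow-change : ∀ i a → inflow f̄ a i *ℚ μ⁻¹ i ≡ inflow f a i *ℚ μ⁻¹ i + contribution a i
    inflow-change i a with head a ≟ i | tail a ≟ i
    ... | yes refl | yes t≡h =
      trans (loop (γ a) (f a) (f̄ a) (μ⁻¹ (head a)))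
            (cong (λ j → (γ a *ℚ f a - f a) *ℚ μ⁻¹ (head a) + (α a - (f̄ a - f a) *ℚ μ⁻¹ j))
                  (sym t≡h))
      where
      loop : ∀ g x x̄ w →
        (g *ℚ x̄ - x̄) *ℚ w ≡ (g *ℚ x - x) *ℚ w + (g *ℚ (x̄ - x) *ℚ w - (x̄ - x) *ℚ w)
      loop = solve-∀ ringℚ
    ... | yes refl | no _ = into (γ a) (f a) (f̄ a) (μ⁻¹ (head a))
      where
      into : ∀ g x x̄ w →
        (g *ℚ x̄ - 0ℚ) *ℚ w ≡ (g *ℚ x - 0ℚ) *ℚ w + (g *ℚ (x̄ - x) *ℚ w - 0ℚ)
      into = solve-∀ ringℚ
    ... | no _ | yes refl = out (f a) (f̄ a) (μ⁻¹ (tail a))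
      where
      out : ∀ x x̄ w → (0ℚ - x̄) *ℚ w ≡ (0ℚ - x) *ℚ w + (0ℚ - (x̄ - x) *ℚ w)
      out = solve-∀ ringℚ
    ... | no _ | no _ = sym (+-identityʳ _)

    excessμ-change : ∀ i → excessμ N f̄ L i ≡ excessμ N f L i + nodeChange i
    excessμ-change i = begin
      excessμ N f̄ L i                              ≡⟨ excessμ≡∑inflow f̄ i ⟩
      ∑ (λ a → inflow f̄ a i *ℚ μ⁻¹ i) - bμ         ≡⟨ cong (_- bμ) (∑-cong (inflow-change i)) ⟩
      ∑ (λ a → inflowμ a + contribution a i) - bμ  ≡⟨ cong (_- bμ) (∑-distrib-+ inflowμ _) ⟩
      (∑ inflowμ + nodeChange i) - bμ              ≡⟨ swap (∑ inflowμ) (nodeChange i) bμ ⟩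
      (∑ inflowμ - bμ) + nodeChange i              ≡⟨ cong (_+ nodeChange i) (excessμ≡∑inflow f i) ⟨
      excessμ N f L i + nodeChange i               ∎
      where
      open ≡-Reasoning
      bμ : ℚ
      bμ = b i *ℚ μ⁻¹ i
      inflowμ : Fin m → ℚ
      inflowμ a = inflow f a i *ℚ μ⁻¹ i
      swap : ∀ x y z → (x + y) - z ≡ (x - z) + y
      swap = solve-∀ ringℚ

    nodeChange-lower : ∀ i → - (deg N i *ℚ δ) ≤ nodeChange i
    nodeChange-lower i = begin
      - (∑ (λ a → incident a i) *ℚ δ)   ≡⟨ cong -_ (∑-*ʳ (λ a → incident a i) δ) ⟨
      - ∑ (λ a → incident a i *ℚ δ)     ≡⟨ ∑-neg (λ a → incident a i *ℚ δ) ⟨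
      ∑ (λ a → - (incident a i *ℚ δ))   ≤⟨ ∑-mono-≤ arc ⟩
      nodeChange i                      ∎
      where
      open ≤-Reasoning
      arc : ∀ a → - (incident a i *ℚ δ) ≤ contribution a i
      arc a = contribution-lower 0≤δ (bounded a) (atHead a i) (atTail a i)

    negative-preserved : ∀ i → Negative N f̄ L Δ' i → Negative N f L Δ i
    negative-preserved i ē<dΔ' = begin-strict
      e                           ≡⟨ shift e (d *ℚ δ) ⟩
      (e + - (d *ℚ δ)) + d *ℚ δ   ≤⟨ +-monoˡ-≤ (d *ℚ δ) (+-monoʳ-≤ e (nodeChange-lower i)) ⟩
      (e + nodeChange i) + d *ℚ δ ≡⟨ cong (_+ d *ℚ δ) (excessμ-change i) ⟨
      ē + d *ℚ δ                  <⟨ +-monoˡ-< (d *ℚ δ) ē<dΔ' ⟩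
      d *ℚ Δ' + d *ℚ δ            ≡⟨ *-distribˡ-+ d Δ' δ ⟨
      d *ℚ (Δ' + δ)               ≡⟨ cong (d *ℚ_) (p+[q-p]≡q Δ' Δ) ⟩
      d *ℚ Δ                      ∎
      where
      open ≤-Reasoning
      e ē d : ℚ
      e = excessμ N f L i
      ē = excessμ N f̄ L i
      d = deg N i
      shift : ∀ x y → x ≡ (x + - y) + y
      shift = solve-∀ ringℚ

    degreeCharge valueCharge charge : Fin m → Fin n → ℚ
    degreeCharge a i = when (atTail a i) δ + when (atHead a i) δ
    valueCharge a i = when (atHead a i) (α a ⁺) + when (atTail a i) ((- β a) ⁺)
    charge a i = degreeCharge a i + valueCharge a i

    nodeCharge : Fin n → ℚ
    nodeCharge i = ∑ (λ a → charge a i)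

    0≤charge : ∀ a i → 0ℚ ≤ charge a i
    0≤charge a i =
      +-mono-≤ (+-mono-≤ (0≤when (atTail a i) 0≤δ) (0≤when (atHead a i) 0≤δ))
               (+-mono-≤ (0≤when (atHead a i) (0≤⁺ (α a))) (0≤when (atTail a i) (0≤⁺ (- β a))))

    ∑charge≤3δ : ∀ a → ∑ (charge a) ≤ (δ + δ) + δ
    ∑charge≤3δ a = begin
      ∑ (charge a)
        ≡⟨ ∑-distrib-+ (degreeCharge a) (valueCharge a) ⟩
      ∑ (degreeCharge a) + ∑ (valueCharge a)
        ≡⟨ cong₂ _+_ (∑-indicator₂ (tail a) (head a) δ δ)
                     (∑-indicator₂ (head a) (tail a) (α a ⁺) ((- β a) ⁺)) ⟩
      (δ + δ) + (α a ⁺ + (- β a) ⁺)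
        ≤⟨ +-monoʳ-≤ (δ + δ) (StepBound⇒α⁺+[-β]⁺≤δ 0≤δ (bounded a)) ⟩
      (δ + δ) + δ
        ∎
      where open ≤-Reasoning

    degree+nodeChange≤nodeCharge : ∀ i → deg N i *ℚ δ + nodeChange i ≤ nodeCharge i
    degree+nodeChange≤nodeCharge i = begin
      ∑ (λ a → incident a i) *ℚ δ + nodeChange i
        ≡⟨ cong (_+ nodeChange i) (∑-*ʳ (λ a → incident a i) δ) ⟨
      ∑ (λ a → incident a i *ℚ δ) + nodeChange i
        ≡⟨ ∑-distrib-+ (λ a → incident a i *ℚ δ) (λ a → contribution a i) ⟨
      ∑ (λ a → incident a i *ℚ δ + contribution a i)
        ≤⟨ ∑-mono-≤ arc ⟩
      nodeCharge i
        ∎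
      where
      open ≤-Reasoning
      arc : ∀ a → incident a i *ℚ δ + contribution a i ≤ charge a i
      arc a = +-mono-≤ (when-∨-≤ 0≤δ (atTail a i) (atHead a i))
                       (contribution-upper (atHead a i) (atTail a i) (α a) (β a))

    gap : Flow N → ℚ → Fin n → ℚ
    gap g D i = (excessμ N g L i - deg N i *ℚ D) ⁺

    gap≤gap+nodeCharge : ∀ i → gap f̄ Δ' i ≤ gap f Δ i + nodeCharge i
    gap≤gap+nodeCharge i = ⁺-≤-+ {y = e - d *ℚ Δ} shifted (∑-nonNeg (λ a → 0≤charge a i))
      where
      e d : ℚ
      e = excessμ N f L i
      d = deg N i
      regroup : ∀ e C d Δ Δ' → (e + C) - d *ℚ Δ' ≡ (e - d *ℚ Δ) + (d *ℚ (Δ - Δ') + C)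
      regroup = solve-∀ ringℚ
      shifted : excessμ N f̄ L i - d *ℚ Δ' ≤ (e - d *ℚ Δ) + nodeCharge i
      shifted = begin
        excessμ N f̄ L i - d *ℚ Δ'         ≡⟨ cong (_- d *ℚ Δ') (excessμ-change i) ⟩
        (e + nodeChange i) - d *ℚ Δ'      ≡⟨ regroup e (nodeChange i) d Δ Δ' ⟩
        (e - d *ℚ Δ) + (d *ℚ δ + nodeChange i)
          ≤⟨ +-monoʳ-≤ (e - d *ℚ Δ) (degree+nodeChange≤nodeCharge i) ⟩
        (e - d *ℚ Δ) + nodeCharge i       ∎
        where open ≤-Reasoning

    Ex-bound : Ex N f̄ L Δ' ≤ Ex N f L Δ + ℕtoℚ (3 * m) *ℚ δ
    Ex-bound = begin
      ∑ (gap f̄ Δ')                              ≤⟨ ∑-mono-≤ gap≤gap+nodeCharge ⟩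
      ∑ (λ i → gap f Δ i + nodeCharge i)        ≡⟨ ∑-distrib-+ (gap f Δ) nodeCharge ⟩
      Ex₀ + ∑ nodeCharge                        ≡⟨ cong (Ex₀ +_) (∑-comm (λ i a → charge a i)) ⟩
      Ex₀ + ∑ (λ a → ∑ (charge a))              ≤⟨ +-monoʳ-≤ Ex₀ (∑-mono-≤ ∑charge≤3δ) ⟩
      Ex₀ + ∑ {m} (λ _ → (δ + δ) + δ)           ≡⟨ cong (Ex₀ +_) (∑-const {m} ((δ + δ) + δ)) ⟩
      Ex₀ + ℕtoℚ m *ℚ ((δ + δ) + δ)             ≡⟨ cong (Ex₀ +_) (ℕtoℚ[3*k]*x m δ) ⟨
      Ex₀ + ℕtoℚ (3 * m) *ℚ δ                   ∎
      where
      open ≤-Reasoning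
      Ex₀ : ℚ
      Ex₀ = Ex N f L Δ

-- Rounding to a Δ'-conservative pseudoflow

module Rounding (N : Network) (f : Flow N) (pf : Pseudoflow N f) (L : Labeling N)
  (Δ Δ' : ℚ) (0≤Δ' : 0ℚ ≤ Δ') (Δ'<Δ : Δ' < Δ) (cons : Conservative N f L Δ) where
  open Network N
  open Labeling L
  open Relabeled N L

  δ : ℚ
  δ = Δ - Δ'

  0≤δ : 0ℚ ≤ δ
  0≤δ = p≤q⇒0≤q-p (<⇒≤ Δ'<Δ)

  0<Δ : 0ℚ < Δ
  0<Δ = ≤-<-trans 0≤Δ' Δ'<Δ

  Δ'≤[s-δ]⁺⇒Δ≤s : ∀ {s} → 0ℚ < (s - δ) ⁺ → Δ' ≤ (s - δ) ⁺ → Δ ≤ s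
  Δ'≤[s-δ]⁺⇒Δ≤s {s} 0<T Δ'≤T = begin
    Δ             ≡⟨ p+[q-p]≡q Δ' Δ ⟨
    Δ' + δ        ≤⟨ +-monoˡ-≤ δ (subst (Δ' ≤_) (0<⁺⇒⁺≡ {s - δ} 0<T) Δ'≤T) ⟩
    (s - δ) + δ   ≡⟨ q-p+p≡q s δ ⟩
    s             ∎
    where open ≤-Reasoning

  record Adjusted (a : Fin m) : Set where
    field
      value    : ℚ
      feasible : (0ℚ ≤ value) × (value ≤ u a)
      bounded  : StepBound δ (headChange a (f a) value) (tailChange a (f a) value)
      fwd-ok   : value < u a → Δ' ≤ fwdFat a value → fwdGain a ≤ 1ℚ
      bwd-ok   : 0ℚ < value → Δ' ≤ bwdFat a value → bwdGain a ≤ 1ℚ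

  push : ∀ a → 1ℚ < fwdGain a → Adjusted a
  push a 1<G = record
    { value    = x
    ; feasible = ≤-trans (proj₁ (pf a)) f≤x , p-q≤p (u a) 0≤pushed
    ; bounded  = inj₁ (0≤β , β≤α , α≤δ)
    ; fwd-ok   = fwd-ok
    ; bwd-ok   = λ _ _ → p*q≡1∧1<q⇒p≤1 (bwdGain*fwdGain a) 1<G
    }
    where
    s T x α β : ℚ
    s = fwdFat a (f a)
    T = (s - δ) ⁺
    x = u a - T *ℚ μ (head a) *ℚ γ⁻¹ a
    α = headChange a (f a) x
    β = tailChange a (f a) x

    0≤pushed : 0ℚ ≤ T *ℚ μ (head a) *ℚ γ⁻¹ a
    0≤pushed = 0≤* (0≤* (0≤⁺ (s - δ)) (<⇒≤ (0<μ (head a)))) (<⇒≤ (0<γ⁻¹ a))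

    fat-x : fwdFat a x ≡ T
    fat-x = begin
      fwdFat a x
        ≡⟨ regroup (γ a) (u a) T (μ (head a)) (γ⁻¹ a) (μ⁻¹ (head a)) ⟩
      T *ℚ ((γ a *ℚ γ⁻¹ a) *ℚ (μ (head a) *ℚ μ⁻¹ (head a)))
        ≡⟨ cong (T *ℚ_) (cong₂ _*ℚ_ (γ*γ⁻¹ a) (μ*μ⁻¹ (head a))) ⟩
      T *ℚ 1ℚ
        ≡⟨ *-identityʳ T ⟩
      T ∎
      where
      open ≡-Reasoning
      regroup : ∀ g u T h g⁻¹ h⁻¹ →
        g *ℚ (u - (u - T *ℚ h *ℚ g⁻¹)) *ℚ h⁻¹ ≡ T *ℚ ((g *ℚ g⁻¹) *ℚ (h *ℚ h⁻¹))
      regroup = solve-∀ ringℚ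

    α≡s-T : α ≡ s - T
    α≡s-T = trans (headChange≡Δfwd a (f a) x) (cong (_-_ s) fat-x)

    0≤α : 0ℚ ≤ α
    0≤α = subst (0ℚ ≤_) (sym α≡s-T) (0≤p-[p-q]⁺ (0≤fwdFat (proj₂ (pf a))) 0≤δ)

    α≤δ : α ≤ δ
    α≤δ = subst (_≤ δ) (sym α≡s-T) (p-[p-q]⁺≤q s δ)

    0≤β : 0ℚ ≤ β
    0≤β = 0≤*⇒0≤ (0<fwdGain a) (subst (0ℚ ≤_) (headChange≡tailChange*fwdGain a (f a) x) 0≤α)

    β≤α : β ≤ α
    β≤α = begin
      β                 ≡⟨ *-identityʳ β ⟨
      β *ℚ 1ℚ           ≤⟨ *-monoˡ-≤-nonNeg β {{nonNegative 0≤β}} (<⇒≤ 1<G) ⟩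
      β *ℚ fwdGain a    ≡⟨ headChange≡tailChange*fwdGain a (f a) x ⟨
      α                 ∎
      where open ≤-Reasoning

    f≤x : f a ≤ x
    f≤x = 0≤q-p⇒p≤q (0≤*⇒0≤ (0<μ⁻¹ (tail a)) 0≤β)

    fwd-ok : x < u a → Δ' ≤ fwdFat a x → fwdGain a ≤ 1ℚ
    fwd-ok x<u Δ'≤fat = proj₁ cons a (0<fwdFat⇒< (<-≤-trans 0<Δ Δ≤s)) Δ≤s
      where
      Δ≤s : Δ ≤ s
      Δ≤s = Δ'≤[s-δ]⁺⇒Δ≤s (subst (0ℚ <_) fat-x (<⇒0<fwdFat x<u)) (subst (Δ' ≤_) fat-x Δ'≤fat)

  pull : ∀ a → 1ℚ < bwdGain a → Adjusted a
  pull a 1<Ḡ = record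
    { value    = x
    ; feasible = 0≤x , ≤-trans x≤f (proj₂ (pf a))
    ; bounded  = inj₂ (-δ≤β , β≤α , α≤0)
    ; fwd-ok   = λ _ _ → G≤1
    ; bwd-ok   = bwd-ok
    }
    where
    G≤1 : fwdGain a ≤ 1ℚ
    G≤1 = p*q≡1∧1<q⇒p≤1 (fwdGain*bwdGain a) 1<Ḡ

    s T x α β : ℚ
    s = bwdFat a (f a)
    T = (s - δ) ⁺
    x = T *ℚ μ (tail a)
    α = headChange a (f a) x
    β = tailChange a (f a) x

    0≤x : 0ℚ ≤ x
    0≤x = 0≤* (0≤⁺ (s - δ)) (<⇒≤ (0<μ (tail a)))

    fat-x : bwdFat a x ≡ T
    fat-x = trans (*-assoc T (μ (tail a)) (μ⁻¹ (tail a)))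
                  (trans (cong (T *ℚ_) (μ*μ⁻¹ (tail a))) (*-identityʳ T))

    β≡-[s-T] : β ≡ - (s - T)
    β≡-[s-T] = trans (tailChange≡Δbwd a (f a) x) (trans (cong (_- s) fat-x) (q-p≡-[p-q] T s))
      where
      q-p≡-[p-q] : ∀ q p → q - p ≡ - (p - q)
      q-p≡-[p-q] = solve-∀ ringℚ

    β≤0 : β ≤ 0ℚ
    β≤0 = subst (_≤ 0ℚ) (sym β≡-[s-T])
                (neg-antimono-≤ (0≤p-[p-q]⁺ (0≤bwdFat (proj₁ (pf a))) 0≤δ))

    -δ≤β : - δ ≤ β
    -δ≤β = subst (- δ ≤_) (sym β≡-[s-T]) (neg-antimono-≤ (p-[p-q]⁺≤q s δ))

    β≤α : β ≤ α
    β≤α = begin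
      β                 ≡⟨ *-identityʳ β ⟨
      β *ℚ 1ℚ           ≤⟨ *-monoˡ-≤-nonPos β {{nonPositive β≤0}} G≤1 ⟩
      β *ℚ fwdGain a    ≡⟨ headChange≡tailChange*fwdGain a (f a) x ⟨
      α                 ∎
      where open ≤-Reasoning

    α≤0 : α ≤ 0ℚ
    α≤0 = begin
      α                 ≡⟨ headChange≡tailChange*fwdGain a (f a) x ⟩
      β *ℚ fwdGain a    ≤⟨ *-monoʳ-≤-nonNeg (fwdGain a) {{nonNegative 0≤G}} β≤0 ⟩
      0ℚ *ℚ fwdGain a   ≡⟨ *-zeroˡ (fwdGain a) ⟩
      0ℚ                ∎
      where
      open ≤-Reasoning
      0≤G : 0ℚ ≤ fwdGain a
      0≤G = <⇒≤ (0<fwdGain a)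

    x≤f : x ≤ f a
    x≤f = q-p≤0⇒q≤p (*≤0⇒≤0 (0<μ⁻¹ (tail a)) β≤0)

    bwd-ok : 0ℚ < x → Δ' ≤ bwdFat a x → bwdGain a ≤ 1ℚ
    bwd-ok 0<x Δ'≤fat = proj₁ (proj₂ cons) a (0<bwdFat⇒0< (<-≤-trans 0<Δ Δ≤s)) Δ≤s
      where
      Δ≤s : Δ ≤ s
      Δ≤s = Δ'≤[s-δ]⁺⇒Δ≤s (subst (0ℚ <_) fat-x (0<⇒0<bwdFat 0<x)) (subst (Δ' ≤_) fat-x Δ'≤fat)

  keep : ∀ a → fwdGain a ≤ 1ℚ → bwdGain a ≤ 1ℚ → Adjusted a
  keep a G≤1 Ḡ≤1 = record
    { value    = f a
    ; feasible = pf a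
    ; bounded  = subst₂ (StepBound δ) (sym no-head-change) (sym no-tail-change)
                        (inj₁ (≤-refl , ≤-refl , 0≤δ))
    ; fwd-ok   = λ _ _ → G≤1
    ; bwd-ok   = λ _ _ → Ḡ≤1
    }
    where
    no-head-change : headChange a (f a) (f a) ≡ 0ℚ
    no-head-change = trans (headChange≡Δfwd a (f a) (f a)) (+-inverseʳ (fwdFat a (f a)))
    no-tail-change : tailChange a (f a) (f a) ≡ 0ℚ
    no-tail-change = trans (tailChange≡Δbwd a (f a) (f a)) (+-inverseʳ (bwdFat a (f a)))

  adjust : ∀ a → Adjusted a
  adjust a with 1ℚ <? fwdGain a | 1ℚ <? bwdGain a
  ... | yes 1<G | _       = push a 1<G
  ... | no 1≮G  | yes 1<Ḡ = pull a 1<Ḡ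
  ... | no 1≮G  | no 1≮Ḡ  = keep a (≮⇒≥ 1≮G) (≮⇒≥ 1≮Ḡ)

  open module Adjust a = Adjusted (adjust a) public

  f̄ : Flow N
  f̄ = value

lemma2 : (N : Network) (f : Flow N) → Pseudoflow N f →
    (L : Labeling N) (Δ Δ' : ℚ) → 0ℚ ≤ Δ' → Δ' < Δ →
    Conservative N f L Δ →
    Σ (Flow N) (λ f̄ →
      Pseudoflow N f̄ ×
      Conservative N f̄ L Δ' ×
      (Ex N f̄ L Δ' ≤ Ex N f L Δ + ℕtoℚ (3 * Network.m N) *ℚ (Δ - Δ')))
lemma2 N f pf L Δ Δ' 0≤Δ' Δ'<Δ cons@(_ , _ , μ≥M⁻¹ , negative⇒μ≡M⁻¹) =
  f̄ ,
  feasible ,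
  (fwd-ok , bwd-ok , μ≥M⁻¹ , λ i → negative⇒μ≡M⁻¹ i ∘ negative-preserved i) ,
  Ex-bound
  where
  open Rounding N f pf L Δ Δ' 0≤Δ' Δ'<Δ cons
  open Relabeled.FlowChange N L f f̄ Δ Δ' (<⇒≤ Δ'<Δ) bounded
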